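{- Let $G$ be a primitive $2$-closed permutation group of degree $n$. If $G$ is not the automorphism group of any graph or digraph of order $n$, then $G$ has rank at least $4$. Moreover, if $G$ has rank $4$ and is the automorphism group of some graph or digraph, then $G$ is the automorphism group of one of its orbital digraphs.
   Context: A permutation group $G$ on $\Omega$ is $2$-closed if it equals the largest subgroup of $\mathrm{Sym}(\Omega)$ having the same orbits as $G$ on $\Omega\times\Omega$. The rank is the number of orbits of $G$ on $\Omega\times\Omega$. An orbital digraph of $G$ has vertex set $\Omega$ and arc set a single $G$-orbit on $\Omega\times\Omega$. -}

module Defs where

open import Level using (0ℓ)
open import Data.Nat using (ℕ; _≤_)
open import Data.Fin using (Fin)
open import Data.Fin.Subset using (Subset; _∈_; _∉_; ∣_∣)
open import Data.Fin.Permutation using (Permutation′; _⟨$⟩ʳ_; _≈_; id; flip; _∘ₚ_)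
open import Data.Product using (Σ; ∃; _×_; _,_)
open import Data.Sum using (_⊎_)
open import Data.Bool using (Bool; T)
open import Relation.Binary.PropositionalEquality using (_≡_; _≢_)
open import Relation.Nullary using (¬_)
open import Function.Bundles using (_⇔_)

record PermGroup (n : ℕ) : Set₁ where
  field
    _∈G   : Permutation′ n → Set
    resp  : ∀ {σ τ} → σ ≈ τ → σ ∈G → τ ∈G
    id∈   : id ∈G
    ∘∈    : ∀ {σ τ} → σ ∈G → τ ∈G → (σ ∘ₚ τ) ∈G
    flip∈ : ∀ {σ} → σ ∈G → flip σ ∈G
open PermGroup public

module _ {n : ℕ} (G : PermGroup n) where

  SameOrbital : Fin n × Fin n → Fin n × Fin n → Set
  SameOrbital (a , b) (c , d) =
    Σ (Permutation′ n) λ g → (G ∈G) g × (g ⟨$⟩ʳ a ≡ c) × (g ⟨$⟩ʳ b ≡ d)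

  -- G has rank r: there are exactly r orbits of G on Ω × Ω, witnessed by
  -- r pairwise inequivalent representatives covering Ω × Ω.
  HasRank : ℕ → Set
  HasRank r = Σ (Fin r → Fin n × Fin n) λ rep →
      (∀ i j → SameOrbital (rep i) (rep j) → i ≡ j)
    × (∀ p → Σ (Fin r) λ i → SameOrbital p (rep i))

  TwoClosed : Set
  TwoClosed = ∀ (σ : Permutation′ n) →
    (∀ a b → SameOrbital (a , b) (σ ⟨$⟩ʳ a , σ ⟨$⟩ʳ b)) → (G ∈G) σ

  Transitive : Set
  Transitive = ∀ a b → Σ (Permutation′ n) λ g → (G ∈G) g × (g ⟨$⟩ʳ a ≡ b)

  IsBlock : Subset n → Set
  IsBlock B = ∀ g → (G ∈G) g →
      (∀ x → (x ∈ B) ⇔ (g ⟨$⟩ʳ x ∈ B))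
    ⊎ (∀ x → x ∈ B → g ⟨$⟩ʳ x ∉ B)

  Primitive : Set
  Primitive = Transitive × (∀ B → IsBlock B → ∣ B ∣ ≤ 1 ⊎ ∣ B ∣ ≡ n)

  IsAutGroupOf : (Fin n → Fin n → Set) → Set
  IsAutGroupOf E = ∀ (σ : Permutation′ n) →
    (G ∈G) σ ⇔ (∀ a b → E a b ⇔ E (σ ⟨$⟩ʳ a) (σ ⟨$⟩ʳ b))

  OrbitalArc : Fin n → Fin n → Fin n → Fin n → Set
  OrbitalArc x y a b = SameOrbital (x , y) (a , b)

-- A digraph of order n (loopless; a graph is a symmetric digraph)
record Digraph (n : ℕ) : Set where
  field
    arc   : Fin n → Fin n → Bool
    loopless : ∀ v → ¬ T (arc v v)
open Digraph public

IsAutGroup : ∀ {n} → PermGroup n → Set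
IsAutGroup {n} G = Σ (Digraph n) λ Γ → IsAutGroupOf G (λ a b → T (arc Γ a b))

-- The arc set of any G-invariant digraph is a union of orbitals, so a
-- permutation preserving it preserves the colouring of the orbitals by
-- "is an arc / is not an arc". If one off-diagonal orbital k is preserved and
-- the colouring is constant on the remaining off-diagonal orbitals, the whole
-- colouring is preserved, because a permutation also preserves the diagonal.
-- For rank 2 or 3 the identity colouring is constant off the diagonal and
-- one orbital k, so by 2-closure G is the automorphism group of the orbital
-- digraph of k; for rank at most 1, G = Sym(Ω) is that of the empty digraph. For rank 4, two of the three off-diagonal orbitals receive
-- the same colour from a digraph Γ with Aut Γ = G; taking k to be the third,
-- G is the automorphism group of the orbital digraph of k.
module Submission where

open import Defs
open import Data.Bool using (Bool; true; false; not; T)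
open import Data.Bool.Properties using (¬-not) renaming (_≟_ to _≟ᵇ_)
open import Data.Empty using (⊥-elim)
open import Data.Fin using (Fin; zero; suc; punchIn; punchOut)
open import Data.Fin.Patterns using (0F; 1F; 2F)
open import Data.Fin.Properties
  using (_≟_; punchInᵢ≢i; punchIn-punchOut; punchOut-injective)
open import Data.Fin.Permutation using (Permutation′; _⟨$⟩ʳ_; flip; _∘ₚ_; inverseˡ)
open import Data.Nat using (ℕ; zero; suc; _≤_; _<_; z≤n; s≤s; _≤?_)
open import Data.Nat.Properties using (≰⇒>)
open import Data.Product using (Σ; ∃-syntax; _×_; _,_; proj₁; proj₂)
open import Function using (_∘_; id)
open import Function.Bundles using (_⇔_; mk⇔; Equivalence; Injection)
open import Function.Construct.Composition using (_⇔-∘_)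
open import Function.Construct.Symmetry using (⇔-sym)
open import Function.Properties.Inverse using (↔⇒↣)
open import Relation.Binary.PropositionalEquality
open import Relation.Nullary using (¬_; yes; no)
open import Relation.Nullary.Decidable using (⌊_⌋; toWitness; fromWitness)

open Equivalence using (to; from)

private
  variable
    m n r : ℕ

Fin≤1-irrelevant : m ≤ 1 → (i j : Fin m) → i ≡ j
Fin≤1-irrelevant (s≤s z≤n) zero zero = refl

≢-unique : m ≤ 1 → {i j k : Fin (suc m)} → i ≢ k → j ≢ k → i ≡ j
≢-unique m≤1 i≢k j≢k =
  punchOut-injective (i≢k ∘ sym) (j≢k ∘ sym) (Fin≤1-irrelevant m≤1 _ _)

ConstantOff : ∀ {a} {X : Set a} → Fin r → Fin r → (Fin r → X) → Set a
ConstantOff d k h = ∀ i j → i ≢ d → i ≢ k → j ≢ d → j ≢ k → h i ≡ h j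

ConstantOff-punchIn : ∀ {a} {X : Set a} (d : Fin (suc r)) (k : Fin r) (h : Fin (suc r) → X) →
  (∀ i j → i ≢ k → j ≢ k → h (punchIn d i) ≡ h (punchIn d j)) →
  ConstantOff d (punchIn d k) h
ConstantOff-punchIn d k h constant i j i≢d i≢k j≢d j≢k = begin
  h i                             ≡⟨ cong h (sym (punchIn-punchOut d≢i)) ⟩
  h (punchIn d (punchOut d≢i))    ≡⟨ constant _ _ (avoids d≢i i≢k) (avoids d≢j j≢k) ⟩
  h (punchIn d (punchOut d≢j))    ≡⟨ cong h (punchIn-punchOut d≢j) ⟩
  h j                             ∎
  where
  open ≡-Reasoning
  d≢i = i≢d ∘ sym
  d≢j = j≢d ∘ sym
  avoids : ∀ {x} (d≢x : d ≢ x) → x ≢ punchIn d k → punchOut d≢x ≢ k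
  avoids d≢x x≢k refl = x≢k (sym (punchIn-punchOut d≢x))

oddOneOut : (g : Fin 3 → Bool) → ∃[ k ] ∀ i j → i ≢ k → j ≢ k → g i ≡ g j
oddOneOut g = k , λ i j i≢k j≢k → trans (agree i i≢k) (sym (agree j j≢k))
  where
  majority : ∃[ k ] ∃[ c ] ∀ i → i ≢ k → g i ≡ c
  majority with g 0F ≟ᵇ g 1F | g 0F ≟ᵇ g 2F
  ... | yes g₀≡g₁ | _ = 2F , g 0F , λ
    { 0F _ → refl ; 1F _ → sym g₀≡g₁ ; 2F 2≢2 → ⊥-elim (2≢2 refl) }
  ... | no _ | yes g₀≡g₂ = 1F , g 0F , λ
    { 0F _ → refl ; 1F 1≢1 → ⊥-elim (1≢1 refl) ; 2F _ → sym g₀≡g₂ }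
  ... | no g₀≢g₁ | no g₀≢g₂ = 0F , not (g 0F) , λ
    { 0F 0≢0 → ⊥-elim (0≢0 refl) ; 1F _ → ¬-not (g₀≢g₁ ∘ sym) ; 2F _ → ¬-not (g₀≢g₂ ∘ sym) }
  k = proj₁ majority
  agree = proj₂ (proj₂ majority)

T-injective : {x y : Bool} → T x ⇔ T y → x ≡ y
T-injective {false} {false} _   = refl
T-injective {false} {true}  x⇔y = ⊥-elim (from x⇔y _)
T-injective {true}  {false} x⇔y = ⊥-elim (to x⇔y _)
T-injective {true}  {true}  _   = refl

module _ (G : PermGroup n) where

  SameOrbital-sym : ∀ {a b c d} → SameOrbital G (a , b) (c , d) → SameOrbital G (c , d) (a , b)
  SameOrbital-sym (g , g∈G , refl , refl) = flip g , flip∈ G g∈G , inverseˡ g , inverseˡ g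

  SameOrbital-trans : ∀ {a b c d e f} → SameOrbital G (a , b) (c , d) →
    SameOrbital G (c , d) (e , f) → SameOrbital G (a , b) (e , f)
  SameOrbital-trans (g , g∈G , refl , refl) (h , h∈G , refl , refl) =
    g ∘ₚ h , ∘∈ G g∈G h∈G , refl , refl

  SameOrbital-image : ∀ {σ} → (G ∈G) σ → ∀ a b → SameOrbital G (a , b) (σ ⟨$⟩ʳ a , σ ⟨$⟩ʳ b)
  SameOrbital-image σ∈G a b = _ , σ∈G , refl , refl

  IsAutGroupOf-cong : {E E′ : Fin n → Fin n → Set} → (∀ a b → E a b ⇔ E′ a b) →
    IsAutGroupOf G E → IsAutGroupOf G E′
  IsAutGroupOf-cong E⇔E′ aut σ = mk⇔
    (λ σ∈G a b → E⇔E′ _ _ ⇔-∘ (to (aut σ) σ∈G a b ⇔-∘ ⇔-sym (E⇔E′ a b)))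
    (λ σ-preserves-E′ → from (aut σ) λ a b →
      ⇔-sym (E⇔E′ _ _) ⇔-∘ (σ-preserves-E′ a b ⇔-∘ E⇔E′ a b))

  isAutGroup-ifSymmetric : (∀ σ → (G ∈G) σ) → IsAutGroup G
  isAutGroup-ifSymmetric all∈G =
    record { arc = λ _ _ → false ; loopless = λ _ () } ,
    λ σ → mk⇔ (λ _ _ _ → mk⇔ (λ ()) (λ ())) (λ _ → all∈G σ)

  module Orbitals (transitive : Transitive G) (rank : HasRank G r) where

    rep : Fin r → Fin n × Fin n
    rep = proj₁ rank

    orbital : Fin n → Fin n → Fin r
    orbital a b = proj₁ (proj₂ (proj₂ rank) (a , b))

    orbital-rep : ∀ a b → SameOrbital G (a , b) (rep (orbital a b))
    orbital-rep a b = proj₂ (proj₂ (proj₂ rank) (a , b))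

    orbital-sound : ∀ {a b c d} → SameOrbital G (a , b) (c , d) → orbital a b ≡ orbital c d
    orbital-sound {a} {b} {c} {d} ab~cd = proj₁ (proj₂ rank) _ _
      (SameOrbital-trans (SameOrbital-sym (orbital-rep a b))
        (SameOrbital-trans ab~cd (orbital-rep c d)))

    orbital-complete : ∀ {a b c d} → orbital a b ≡ orbital c d → SameOrbital G (a , b) (c , d)
    orbital-complete {a} {b} {c} {d} eq = SameOrbital-trans (orbital-rep a b)
      (subst (λ i → SameOrbital G (rep i) (c , d)) (sym eq) (SameOrbital-sym (orbital-rep c d)))

    orbital-diagonal : ∀ a b → orbital a a ≡ orbital b b
    orbital-diagonal a b with transitive a b
    ... | g , g∈G , ga≡b = orbital-sound (g , g∈G , ga≡b , ga≡b)

    orbital-invariant : ∀ {σ} → (G ∈G) σ → ∀ a b → orbital (σ ⟨$⟩ʳ a) (σ ⟨$⟩ʳ b) ≡ orbital a b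
    orbital-invariant σ∈G a b = sym (orbital-sound (SameOrbital-image σ∈G a b))

    orbital-offDiagonal : ∀ {a b} x → a ≢ b → orbital a b ≢ orbital x x
    orbital-offDiagonal x a≢b eq with orbital-complete eq
    ... | g , _ , ga≡x , gb≡x = a≢b (Injection.injective (↔⇒↣ g) (trans ga≡x (sym gb≡x)))

    orbital-rep-self : ∀ k → orbital (proj₁ (rep k)) (proj₂ (rep k)) ≡ k
    orbital-rep-self k = proj₁ (proj₂ rank) _ _ (SameOrbital-sym (orbital-rep _ _))

    orbital≡⇔OrbitalArc : ∀ k a b →
      orbital a b ≡ k ⇔ OrbitalArc G (proj₁ (rep k)) (proj₂ (rep k)) a b
    orbital≡⇔OrbitalArc k a b = mk⇔
      (λ eq → SameOrbital-sym (orbital-complete (trans eq (sym (orbital-rep-self k)))))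
      (λ rep~ab → trans (sym (orbital-sound rep~ab)) (orbital-rep-self k))

    PreservesColouring : ∀ {ℓ} {X : Set ℓ} → (Fin r → X) → Permutation′ n → Set ℓ
    PreservesColouring h σ = ∀ a b → h (orbital (σ ⟨$⟩ʳ a) (σ ⟨$⟩ʳ b)) ≡ h (orbital a b)

    preservesColouring : ∀ {ℓ} {X : Set ℓ} x k (h : Fin r → X) → ConstantOff (orbital x x) k h →
      ∀ σ → (∀ a b → orbital a b ≡ k ⇔ orbital (σ ⟨$⟩ʳ a) (σ ⟨$⟩ʳ b) ≡ k) →
      PreservesColouring h σ
    preservesColouring x k h constant σ σ-preserves-k a b with a ≟ b | orbital a b ≟ k
    ... | yes refl | _ = cong h (orbital-diagonal _ _)
    ... | no _ | yes ab∈k = cong h (trans (to (σ-preserves-k a b) ab∈k) (sym ab∈k))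
    ... | no a≢b | no ab∉k = constant _ _
      (orbital-offDiagonal x (a≢b ∘ Injection.injective (↔⇒↣ σ)))
      (ab∉k ∘ from (σ-preserves-k a b))
      (orbital-offDiagonal x a≢b) ab∉k

    isAutGroupOf-orbital : ∀ {ℓ} {X : Set ℓ} x k (h : Fin r → X) → ConstantOff (orbital x x) k h →
      (∀ σ → PreservesColouring h σ → (G ∈G) σ) → IsAutGroupOf G (λ a b → orbital a b ≡ k)
    isAutGroupOf-orbital x k h constant determined σ = mk⇔
      (λ σ∈G a b → mk⇔ (trans (orbital-invariant σ∈G a b)) (trans (sym (orbital-invariant σ∈G a b))))
      (determined σ ∘ preservesColouring x k h constant σ)

    orbitalDigraph : ∀ k → (∀ a → orbital a a ≢ k) → Digraph n
    orbitalDigraph k k-offDiagonal = record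
      { arc = λ a b → ⌊ orbital a b ≟ k ⌋
      ; loopless = λ a aa∈k → k-offDiagonal a (toWitness aa∈k)
      }

    isAutGroup-orbitalDigraph : ∀ k → (∀ a → orbital a a ≢ k) →
      IsAutGroupOf G (λ a b → orbital a b ≡ k) → IsAutGroup G
    isAutGroup-orbitalDigraph k k-offDiagonal aut =
      orbitalDigraph k k-offDiagonal , IsAutGroupOf-cong (λ _ _ → mk⇔ fromWitness toWitness) aut

    twoClosed-preservesOrbitals⇒∈G : TwoClosed G → ∀ σ → PreservesColouring id σ → (G ∈G) σ
    twoClosed-preservesOrbitals⇒∈G twoClosed σ preserves =
      twoClosed σ λ a b → orbital-complete (sym (preserves a b))

    arcColour : Digraph n → Fin r → Bool
    arcColour Γ i = arc Γ (proj₁ (rep i)) (proj₂ (rep i))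

    arc≡arcColour : (Γ : Digraph n) → IsAutGroupOf G (λ a b → T (arc Γ a b)) →
      ∀ a b → arc Γ a b ≡ arcColour Γ (orbital a b)
    arc≡arcColour Γ aut a b with orbital-rep a b
    ... | g , g∈G , ga≡x , gb≡y =
      T-injective (subst₂ (λ x y → T (arc Γ a b) ⇔ T (arc Γ x y)) ga≡x gb≡y (to (aut g) g∈G a b))

    autGroup-preservesArcColour⇒∈G : (Γ : Digraph n) → IsAutGroupOf G (λ a b → T (arc Γ a b)) →
      ∀ σ → PreservesColouring (arcColour Γ) σ → (G ∈G) σ
    autGroup-preservesArcColour⇒∈G Γ aut σ preserves = from (aut σ) λ a b →
      let arcs-equal = begin
            arc Γ a b                                   ≡⟨ arc≡arcColour Γ aut a b ⟩
            arcColour Γ (orbital a b)                   ≡⟨ sym (preserves a b) ⟩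
            arcColour Γ (orbital (σ ⟨$⟩ʳ a) (σ ⟨$⟩ʳ b))  ≡⟨ sym (arc≡arcColour Γ aut _ _) ⟩
            arc Γ (σ ⟨$⟩ʳ a) (σ ⟨$⟩ʳ b)                 ∎
      in mk⇔ (subst T arcs-equal) (subst T (sym arcs-equal))
      where open ≡-Reasoning

isAutGroup-ifRank<4 : (G : PermGroup n) → Transitive G → TwoClosed G → HasRank G r → r < 4 →
  IsAutGroup G
isAutGroup-ifRank<4 {zero} G _ twoClosed _ _ =
  isAutGroup-ifSymmetric G λ σ → twoClosed σ λ ()
isAutGroup-ifRank<4 {suc _} {zero} G transitive _ rank _
  with Orbitals.orbital G transitive rank zero zero
... | ()
isAutGroup-ifRank<4 {suc _} {suc zero} G transitive twoClosed rank _ =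
  isAutGroup-ifSymmetric G λ σ →
    twoClosed-preservesOrbitals⇒∈G twoClosed σ λ _ _ → Fin≤1-irrelevant (s≤s z≤n) _ _
  where open Orbitals G transitive rank
isAutGroup-ifRank<4 {suc _} {suc (suc m)} G transitive twoClosed rank (s≤s (s≤s (s≤s m≤1))) =
  isAutGroup-orbitalDigraph k k-offDiagonal
    (isAutGroupOf-orbital zero k id constant (twoClosed-preservesOrbitals⇒∈G twoClosed))
  where
  open Orbitals G transitive rank
  d = orbital zero zero
  k = punchIn d zero
  k-offDiagonal : ∀ a → orbital a a ≢ k
  k-offDiagonal a aa∈k = punchInᵢ≢i d zero (trans (sym aa∈k) (orbital-diagonal a zero))
  constant : ConstantOff d k id
  constant = ConstantOff-punchIn d zero id λ _ _ i≢0 j≢0 → cong (punchIn d) (≢-unique m≤1 i≢0 j≢0)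

orbitalDigraphAutGroup-ifRank4 : (G : PermGroup n) → Transitive G → HasRank G 4 → IsAutGroup G →
  Σ (Fin n) λ x → Σ (Fin n) λ y → IsAutGroupOf G (OrbitalArc G x y)
orbitalDigraphAutGroup-ifRank4 {zero} G _ rank _ with proj₁ (proj₁ rank zero)
... | ()
orbitalDigraphAutGroup-ifRank4 {suc _} G transitive rank (Γ , aut) =
  proj₁ (rep k) , proj₂ (rep k) ,
  IsAutGroupOf-cong G (orbital≡⇔OrbitalArc k)
    (isAutGroupOf-orbital zero k (arcColour Γ) constant (autGroup-preservesArcColour⇒∈G Γ aut))
  where
  open Orbitals G transitive rank
  d = orbital zero zero
  oddColour = oddOneOut (arcColour Γ ∘ punchIn d)
  k = punchIn d (proj₁ oddColour)
  constant : ConstantOff d k (arcColour Γ)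
  constant = ConstantOff-punchIn d (proj₁ oddColour) (arcColour Γ) (proj₂ oddColour)

lemma4p1 : ∀ {n : ℕ} (G : PermGroup n) → Primitive G → TwoClosed G →
    ((¬ IsAutGroup G) → ∀ r → HasRank G r → 4 ≤ r)
    × (HasRank G 4 → IsAutGroup G →
       Σ (Fin n) λ x → Σ (Fin n) λ y → IsAutGroupOf G (OrbitalArc G x y))
lemma4p1 G (transitive , _) twoClosed =
  rank≥4 , orbitalDigraphAutGroup-ifRank4 G transitive
  where
  rank≥4 : ¬ IsAutGroup G → ∀ r → HasRank G r → 4 ≤ r
  rank≥4 notAutGroup r rank with 4 ≤? r
  ... | yes 4≤r = 4≤r
  ... | no 4≰r = ⊥-elim (notAutGroup (isAutGroup-ifRank<4 G transitive twoClosed rank (≰⇒> 4≰r)))
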